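{- Let $k\in\mathbb{N}$ and, for each $i=1,\ldots,k$, let $f_i(x_{i,1},\ldots,x_{i,n_i})$ be a function of $n_i$ variables defined on $\mathbb{N}^{n_i}$, where the variable sets $\{x_{i,1},\ldots,x_{i,n_i}\}$ ($i=1,\ldots,k$) are pairwise disjoint. For each $i$ fix indices $1\le j^{(i)}_1,\ldots,j^{(i)}_{p_i}\le n_i$ and a number $s_i$. Let $\mathcal{U}$ be an ultrafilter on $\mathbb{N}$ which, for every $i=1,\ldots,k$, is a PR-witness of $f_i(x_{i,1},\ldots,x_{i,n_i})=0$ with injectivity $|\{x_{i,j^{(i)}_1},\ldots,x_{i,j^{(i)}_{p_i}}\}|\ge s_i$. Then $\mathcal{U}$ is also a PR-witness of the system $$f_i(x_{i,1},\ldots,x_{i,n_i})=0\ (i=1,\ldots,k),\qquad x_{1,1}=x_{2,1}=\ldots=x_{k,1},$$ with injectivity $|\{x_{i,j^{(i)}_1},\ldots,x_{i,j^{(i)}_{p_i}}\}|\ge s_i$ for every $i=1,\ldots,k$; that is, for every $A\in\mathcal{U}$ there exist $a_{i,j}\in A$ ($1\le i\le k$, $1\le j\le n_i$) with $f_i(a_{i,1},\ldots,a_{i,n_i})=0$ and $|\{a_{i,j^{(i)}_1},\ldots,a_{i,j^{(i)}_{p_i}}\}|\ge s_i$ for all $i$, and $a_{1,1}=\ldots=a_{k,1}$.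
   Context: $\mathbb{N}$ denotes the set of positive integers. An ultrafilter $\mathcal{U}$ on $\mathbb{N}$ is a PR-witness of $f(x_1,\ldots,x_n)=0$ with injectivity $|\{x_{i_1},\ldots,x_{i_p}\}|\ge s$ if for every $A\in\mathcal{U}$ there exist $a_1,\ldots,a_n\in A$ with $f(a_1,\ldots,a_n)=0$ and $|\{a_{i_1},\ldots,a_{i_p}\}|\ge s$. -}

module Defs where

open import Level using (0ℓ)
open import Data.Nat using (ℕ; _≤_)
open import Data.Nat.Properties using (_≟_)
open import Data.Fin using (Fin)
open import Data.List using (List; length; deduplicate)
open import Data.List using () renaming (tabulate to tabulateL)
open import Data.Product using (Σ; _×_; ∃)
open import Data.Sum using (_⊎_)
open import Data.Empty using (⊥)
open import Data.Unit using (⊤)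
open import Relation.Nullary using (¬_)
open import Relation.Unary using (Pred; _⊆_; _∩_; ∁)
open import Relation.Binary.PropositionalEquality using (_≡_)

record Ultrafilter : Set₂ where
  field
    _∈U   : Pred ℕ 0ℓ → Set₁
    ℕ∈U   : (λ _ → ⊤) ∈U
    ∅∉U   : ¬ ((λ _ → ⊥) ∈U)
    up    : ∀ {A B : Pred ℕ 0ℓ} → A ⊆ B → A ∈U → B ∈U
    inter : ∀ {A B : Pred ℕ 0ℓ} → A ∈U → B ∈U → (A ∩ B) ∈U
    ultra : ∀ (A : Pred ℕ 0ℓ) → A ∈U ⊎ (∁ A) ∈U

open Ultrafilter public

card : ∀ {n p} → (Fin n → ℕ) → (Fin p → Fin n) → ℕ
card a js = length (deduplicate _≟_ (tabulateL (λ t → a (js t))))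

PRWitness : (𝒰 : Ultrafilter) {Y : Set} (y₀ : Y) (n : ℕ) (f : (Fin n → ℕ) → Y)
            {p : ℕ} (js : Fin p → Fin n) (s : ℕ) → Set₁
PRWitness 𝒰 y₀ n f js s =
  ∀ (A : Pred ℕ 0ℓ) → (_∈U 𝒰 A) →
    Σ (Fin n → ℕ) λ a → (∀ j → A (a j)) × (f a ≡ y₀) × (s ≤ card a js)

-- Fix A ∈ 𝒰. For a single equation f(x₀,…,xₘ) = y₀ with an injectivity
-- requirement, let the "first values" of A be the numbers x for which some
-- solution with all entries in A has x₀ = x. This set lies in 𝒰: otherwise
-- its complement does, so A minus the first values is in 𝒰 too. The
-- PR-witness property then yields a solution inside that set, and its own
-- first entry is a first value, which is a contradiction
-- (`firstValues-∈U`). Ultrafilters are closed under finite intersections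
-- (`⋂-∈U`), so the numbers that are first values for every equation form a
-- set in 𝒰. A PR-witness makes every set in 𝒰 inhabited (`∈U-inhabited`),
-- so we pick one such number x. Taking for each equation a solution with
-- first entry x gives the required system solution.
module Submission where

open import Defs
open import Level using (0ℓ)
open import Data.Nat using (ℕ; suc; _≤_)
open import Data.Fin using (Fin; zero; suc)
open import Data.Product using (Σ; _×_; _,_; proj₁; proj₂)
open import Data.Empty using (⊥-elim)
open import Data.Sum using (inj₁; inj₂)
open import Relation.Unary using (Pred)
open import Relation.Binary.PropositionalEquality using (_≡_; refl; sym; trans)

module _ (𝒰 : Ultrafilter) where

  ⋂-∈U : (k : ℕ) (C : Fin k → Pred ℕ 0ℓ) →
    (∀ i → _∈U 𝒰 (C i)) → _∈U 𝒰 (λ x → ∀ i → C i x)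
  ⋂-∈U ℕ.zero C C∈U = up 𝒰 (λ _ ()) (ℕ∈U 𝒰)
  ⋂-∈U (suc k) C C∈U =
    up 𝒰 (λ { (c₀ , cₛ) zero → c₀ ; (c₀ , cₛ) (suc i) → cₛ i })
       (inter 𝒰 (C∈U zero) (⋂-∈U k (λ i → C (suc i)) (λ i → C∈U (suc i))))

  -- If 𝒰 witnesses some equation in at least one variable, every member
  -- of 𝒰 has an explicit element. This is needed because ∅ ∉ 𝒰 alone
  -- only shows that a member is not empty.
  ∈U-inhabited : {Y : Set} (y₀ : Y) {m : ℕ} (f : (Fin (suc m) → ℕ) → Y)
    {p : ℕ} (js : Fin p → Fin (suc m)) (s : ℕ) →
    PRWitness 𝒰 y₀ (suc m) f js s →
    (B : Pred ℕ 0ℓ) → _∈U 𝒰 B → Σ ℕ B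
  ∈U-inhabited y₀ f js s W B B∈U with W B B∈U
  ... | a , a∈B , _ = a zero , a∈B zero

  Solution : (A : Pred ℕ 0ℓ) {Y : Set} (y₀ : Y) {n : ℕ} (f : (Fin n → ℕ) → Y)
    {p : ℕ} (js : Fin p → Fin n) (s : ℕ) → (Fin n → ℕ) → Set
  Solution A y₀ f js s a = (∀ j → A (a j)) × (f a ≡ y₀) × (s ≤ card a js)

  FirstValues : (A : Pred ℕ 0ℓ) {Y : Set} (y₀ : Y) {m : ℕ}
    (f : (Fin (suc m) → ℕ) → Y) {p : ℕ} (js : Fin p → Fin (suc m)) (s : ℕ) →
    Pred ℕ 0ℓ
  FirstValues A y₀ f js s x =
    Σ (Fin _ → ℕ) λ a → Solution A y₀ f js s a × (a zero ≡ x)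

  firstValues-∈U : {Y : Set} (y₀ : Y) {m : ℕ} (f : (Fin (suc m) → ℕ) → Y)
    {p : ℕ} (js : Fin p → Fin (suc m)) (s : ℕ) →
    PRWitness 𝒰 y₀ (suc m) f js s →
    (A : Pred ℕ 0ℓ) → _∈U 𝒰 A → _∈U 𝒰 (FirstValues A y₀ f js s)
  firstValues-∈U y₀ f js s W A A∈U
    with ultra 𝒰 (FirstValues A y₀ f js s)
  ... | inj₁ large = large
  ... | inj₂ small with W _ (inter 𝒰 A∈U small)
  ...   | a , inside , solves , injective =
    ⊥-elim (proj₂ (inside zero) firstValue)
    where
    firstValue : FirstValues A y₀ f js s (a zero)
    firstValue = a , ((λ j → proj₁ (inside j)) , solves , injective) , refl

lemma2p1 : (𝒰 : Ultrafilter) (k : ℕ)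
    (Y : Fin k → Set) (y₀ : (i : Fin k) → Y i)
    (m : Fin k → ℕ)
    (f : (i : Fin k) → (Fin (suc (m i)) → ℕ) → Y i)
    (p : Fin k → ℕ) (js : (i : Fin k) → Fin (p i) → Fin (suc (m i)))
    (s : Fin k → ℕ) →
    (∀ i → PRWitness 𝒰 (y₀ i) (suc (m i)) (f i) (js i) (s i)) →
    ∀ (A : Pred ℕ 0ℓ) → _∈U 𝒰 A →
      Σ ((i : Fin k) → Fin (suc (m i)) → ℕ) λ a →
        (∀ i j → A (a i j))
        × (∀ i → f i (a i) ≡ y₀ i)
        × (∀ i → s i ≤ card (a i) (js i))
        × (∀ i i′ → a i zero ≡ a i′ zero)
-- With no equations there is nothing to solve.
lemma2p1 𝒰 ℕ.zero Y y₀ m f p js s W A A∈U = (λ ()) , (λ ()) , (λ ()) , (λ ()) , (λ ())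
lemma2p1 𝒰 (suc k) Y y₀ m f p js s W A A∈U =
  a , (λ i → proj₁ (solution i)) , (λ i → proj₁ (proj₂ (solution i))) ,
  (λ i → proj₂ (proj₂ (solution i))) , (λ i i′ → trans (startsAt i) (sym (startsAt i′)))
  where
  First : Fin (suc k) → Pred ℕ 0ℓ
  First i = FirstValues 𝒰 A (y₀ i) (f i) (js i) (s i)

  First∈U : ∀ i → _∈U 𝒰 (First i)
  First∈U i = firstValues-∈U 𝒰 (y₀ i) (f i) (js i) (s i) (W i) A A∈U

  Common : Pred ℕ 0ℓ
  Common x = ∀ i → First i x

  chosen : Σ ℕ Common
  chosen = ∈U-inhabited 𝒰 (y₀ zero) (f zero) (js zero) (s zero) (W zero)
             Common (⋂-∈U 𝒰 (suc k) First First∈U)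

  a : (i : Fin (suc k)) → Fin (suc (m i)) → ℕ
  a i = proj₁ (proj₂ chosen i)

  solution : ∀ i → Solution 𝒰 A (y₀ i) (f i) (js i) (s i) (a i)
  solution i = proj₁ (proj₂ (proj₂ chosen i))

  startsAt : ∀ i → a i zero ≡ proj₁ chosen
  startsAt i = proj₂ (proj₂ (proj₂ chosen i))
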